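{- Let $G$ be a finite simple graph with at least one edge, and let $R(G)$ be its regularization. Then \[\frac{|V(R(G))|}{\mathrm{es}_{\Delta}(R(G))}\le \frac{|V(G)|}{\mathrm{es}_{\Delta}(G)}.\]
   Context: $\Delta(G)$ and $\delta(G)$ are the maximum and minimum degree of $G$; $\mathrm{core}(G)$ is the set of vertices of degree $\Delta(G)$. The $\Delta$-edge stability number $\mathrm{es}_{\Delta}(G)$ is the minimum number of edges whose removal results in a subgraph $H$ with $\Delta(H)=\Delta(G)-1$. Regularization: if $G$ is regular, $R(G)=G$. Otherwise, let $A_G=V(G)\setminus\mathrm{core}(G)$, and let $G^{(1)}$ be obtained from two disjoint copies $G',G''$ of $G$ by adding an edge between each vertex of $A_{G'}$ and its corresponding copy in $A_{G''}$; then $\Delta(G^{(1)})=\Delta(G)$ and $\delta(G^{(1)})=\delta(G)+1$. Define $G^{(i+1)}=(G^{(i)})^{(1)}$ iteratively, and $R(G)=G^{(\Delta(G)-\delta(G))}$, which is a $\Delta(G)$-regular graph. -}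

module Defs where

open import Data.Nat using (ℕ; zero; suc; _+_; _*_; _∸_; _≤_; _⊔_; _⊓_; _<ᵇ_; _≡ᵇ_)
open import Data.Fin using (Fin; toℕ; splitAt)
import Data.Fin as F
open import Data.Bool using (Bool; true; false; if_then_else_; _∧_; not)
open import Data.Sum using (inj₁; inj₂)
open import Data.Product using (Σ; ∃; _×_; ∃-syntax)
open import Function using (_∘_)
open import Relation.Binary.PropositionalEquality using (_≡_)

record Graph : Set where
  constructor mkGraph
  field
    order : ℕ
    adj   : Fin order → Fin order → Bool
open Graph public

IsSimple : Graph → Set
IsSimple G = (∀ i j → adj G i j ≡ adj G j i) × (∀ i → adj G i i ≡ false)

HasEdge : Graph → Set
HasEdge G = ∃[ i ] ∃[ j ] (adj G i j ≡ true)

countB : ∀ {n} → (Fin n → Bool) → ℕ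
countB {zero}  f = 0
countB {suc n} f = (if f F.zero then 1 else 0) + countB (f ∘ F.suc)

maxF : ∀ {n} → (Fin n → ℕ) → ℕ
maxF {zero}  f = 0
maxF {suc n} f = f F.zero ⊔ maxF (f ∘ F.suc)

-- minimum over a nonempty index set (0 for the empty graph; irrelevant here)
minF : ∀ {n} → (Fin n → ℕ) → ℕ
minF {zero}        f = 0
minF {suc zero}    f = f F.zero
minF {suc (suc n)} f = f F.zero ⊓ minF (f ∘ F.suc)

deg : (G : Graph) → Fin (order G) → ℕ
deg G i = countB (adj G i)

Δ : Graph → ℕ
Δ G = maxF (deg G)

δ : Graph → ℕ
δ G = minF (deg G)

sumF : ∀ {n} → (Fin n → ℕ) → ℕ
sumF {zero}  f = 0
sumF {suc n} f = f F.zero + sumF (f ∘ F.suc)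

-- number of unordered pairs {i,j} (counted once, as i < j) with r i j = true
countPairs : ∀ {n} → (Fin n → Fin n → Bool) → ℕ
countPairs r = sumF λ i → countB λ j → (toℕ i <ᵇ toℕ j) ∧ r i j

SpanSub : (G : Graph) → (Fin (order G) → Fin (order G) → Bool) → Set
SpanSub G h = IsSimple (mkGraph (order G) h) × (∀ i j → h i j ≡ true → adj G i j ≡ true)

removed : (G : Graph) → (Fin (order G) → Fin (order G) → Bool) → ℕ
removed G h = countPairs λ i j → adj G i j ∧ not (h i j)

IsEsΔ : Graph → ℕ → Set
IsEsΔ G k =
  (∃[ h ] (SpanSub G h × Δ (mkGraph (order G) h) ≡ Δ G ∸ 1 × removed G h ≡ k))
  × (∀ h → SpanSub G h → Δ (mkGraph (order G) h) ≡ Δ G ∸ 1 → k ≤ removed G h)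

-- G^(1): two copies (vertices inj₁ i / inj₂ i via splitAt), with an edge between the
-- two copies of each vertex not in core(G)
double : Graph → Graph
double G = mkGraph (n + n) a
  where
    n = order G
    notCore : Fin n → Bool
    notCore i = not (deg G i ≡ᵇ Δ G)
    a : Fin (n + n) → Fin (n + n) → Bool
    a u v with splitAt n u | splitAt n v
    ... | inj₁ i | inj₁ j = adj G i j
    ... | inj₂ i | inj₂ j = adj G i j
    ... | inj₁ i | inj₂ j = (toℕ i ≡ᵇ toℕ j) ∧ notCore i
    ... | inj₂ i | inj₁ j = (toℕ i ≡ᵇ toℕ j) ∧ notCore i

iter : ℕ → Graph → Graph
iter zero    G = G
iter (suc k) G = iter k (double G)

R : Graph → Graph
R G = iter (Δ G ∸ δ G) G

{-# OPTIONS --safe #-}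
-- Write D = Δ(G) − 1. Putting back a removed edge raises the maximum degree by at most one, so
-- es_Δ(G) is also the least number of edges whose removal brings the maximum degree to at most D.
-- A spanning subgraph of G^(1) of maximum degree at most D restricts to two such subgraphs of the
-- two copies of G, whose removed edges are disjoint; so this least number at least doubles from G
-- to G^(1), while Δ does not grow, since only vertices outside the core gain an edge. After
-- m = Δ(G) − δ(G) doublings, |V(R(G))| = 2^m |V(G)| and es_Δ(R(G)) ≥ 2^m es_Δ(G).

module Submission where

open import Defs
open import Data.Bool using (Bool; true; false; _∧_; _∨_; not; if_then_else_; T)
import Data.Bool.Properties as Bool
open import Data.Bool.Properties using (∨-comm; ∧-comm; ∨-identityʳ; ∨-zeroʳ; ∧-identityʳ; ∧-zeroʳ; ¬-not; T-≡)
open import Data.Empty using (⊥-elim)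
open import Data.Fin using (Fin; toℕ; _↑ˡ_; _↑ʳ_)
import Data.Fin as F
open import Data.Fin.Properties using (_≟_; any?; toℕ-injective; toℕ-↑ˡ; toℕ-↑ʳ; splitAt-↑ˡ; splitAt-↑ʳ)
open import Data.Nat using (ℕ; zero; suc; _+_; _*_; _^_; _∸_; _≤_; _<_; _⊔_; _<ᵇ_; _≡ᵇ_; z≤n; s≤s)
open import Data.Nat.Properties
  using ( ≤-refl; ≤-trans; ≤-reflexive; <-irrefl; <⇒≤; <-≤-trans; <-cmp; _<?_
        ; ≤∧≢⇒<; m≤n⇒m<n∨m≡n; <⇒<ᵇ; ≡⇒≡ᵇ; +-identityʳ; +-comm; +-assoc; +-suc; +-monoʳ-≤; +-mono-≤
        ; +-mono-≤-<; +-mono-<-≤; m≤m+n; m≤n+m; n≤1+n; ⊔-assoc; ⊔-lub; m≤m⊔n; m≤n⊔m; *-comm; *-assoc; *-monoʳ-≤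
        ; m∸n≤m; ∸-monoˡ-≤; module ≤-Reasoning)
open import Data.Nat.Tactic.RingSolver using (solve-∀)
open import Data.Product using (∃-syntax; _×_; _,_; proj₁; proj₂)
open import Data.Sum using (_⊎_; inj₁; inj₂)
open import Function using (_∘_)
open import Function.Bundles using (Equivalence)
open import Data.Nat.Induction using (<-wellFounded)
open import Induction.WellFounded using (Acc; acc)
open import Relation.Binary.Definitions using (tri<; tri≈; tri>)
open import Relation.Binary.PropositionalEquality using (_≡_; _≢_; refl; sym; trans; cong; cong₂; subst)
open import Relation.Nullary using (does; yes; no)
open import Relation.Nullary.Decidable using (_×-dec_)

infix 4 _⊆ᵇ_ _⊆ᵇ₂_

_⊆ᵇ_ : ∀ {n} → (Fin n → Bool) → (Fin n → Bool) → Set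
f ⊆ᵇ g = ∀ x → f x ≡ true → g x ≡ true

_⊆ᵇ₂_ : ∀ {n} → (Fin n → Fin n → Bool) → (Fin n → Fin n → Bool) → Set
r ⊆ᵇ₂ s = ∀ x y → r x y ≡ true → s x y ≡ true

indicator-mono : ∀ {b c} → (b ≡ true → c ≡ true) → (if b then 1 else 0) ≤ (if c then 1 else 0)
indicator-mono {false}         _   = z≤n
indicator-mono {true}  {true}  _   = ≤-refl
indicator-mono {true}  {false} b⇒c with () ← b⇒c refl

countB-cong : ∀ {n} {f g : Fin n → Bool} → (∀ x → f x ≡ g x) → countB f ≡ countB g
countB-cong {zero}  f≗g = refl
countB-cong {suc n} f≗g = cong₂ _+_ (cong (λ b → if b then 1 else 0) (f≗g F.zero)) (countB-cong (f≗g ∘ F.suc))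

countB-mono : ∀ {n} {f g : Fin n → Bool} → f ⊆ᵇ g → countB f ≤ countB g
countB-mono {zero}  f⊆g = z≤n
countB-mono {suc n} f⊆g = +-mono-≤ (indicator-mono (f⊆g F.zero)) (countB-mono (f⊆g ∘ F.suc))

countB-mono-< : ∀ {n} {f g : Fin n → Bool} → f ⊆ᵇ g → ∀ a → f a ≡ false → g a ≡ true → countB f < countB g
countB-mono-< {suc n} f⊆g F.zero    fa ga rewrite fa | ga = s≤s (countB-mono (f⊆g ∘ F.suc))
countB-mono-< {suc n} f⊆g (F.suc a) fa ga =
  +-mono-≤-< (indicator-mono (f⊆g F.zero)) (countB-mono-< (f⊆g ∘ F.suc) a fa ga)

countB-false : ∀ {n} → countB {n} (λ _ → false) ≡ 0
countB-false {zero}  = refl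
countB-false {suc n} = countB-false {n}

countB-≟ : ∀ {n} (b : Fin n) → countB (λ y → does (b ≟ y)) ≡ 1
countB-≟ {suc n} F.zero    = cong suc (countB-false {n})
countB-≟         (F.suc b) = countB-≟ b

countB-∨ : ∀ {n} (f g : Fin n → Bool) → countB (λ x → f x ∨ g x) ≤ countB f + countB g
countB-∨ {zero}  f g = z≤n
countB-∨ {suc n} f g with f F.zero | g F.zero
... | true  | true  = s≤s (≤-trans (countB-∨ (f ∘ F.suc) (g ∘ F.suc)) (+-monoʳ-≤ _ (n≤1+n _)))
... | true  | false = s≤s (countB-∨ (f ∘ F.suc) (g ∘ F.suc))
... | false | true  = ≤-trans (s≤s (countB-∨ (f ∘ F.suc) (g ∘ F.suc))) (≤-reflexive (sym (+-suc _ _)))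
... | false | false = countB-∨ (f ∘ F.suc) (g ∘ F.suc)

countB-split : ∀ m n (f : Fin (m + n) → Bool) → countB f ≡ countB (f ∘ (_↑ˡ n)) + countB (f ∘ (m ↑ʳ_))
countB-split zero    n f = refl
countB-split (suc m) n f = trans (cong (head +_) (countB-split m n (f ∘ F.suc)))
                                 (sym (+-assoc head (countB (f ∘ F.suc ∘ (_↑ˡ n))) (countB (f ∘ F.suc ∘ (m ↑ʳ_)))))
  where head = if f F.zero then 1 else 0

sumF-mono : ∀ {n} {f g : Fin n → ℕ} → (∀ x → f x ≤ g x) → sumF f ≤ sumF g
sumF-mono {zero}  f≤g = z≤n
sumF-mono {suc n} f≤g = +-mono-≤ (f≤g F.zero) (sumF-mono (f≤g ∘ F.suc))

sumF-mono-< : ∀ {n} {f g : Fin n → ℕ} → (∀ x → f x ≤ g x) → ∀ a → f a < g a → sumF f < sumF g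
sumF-mono-< {suc n} f≤g F.zero    fa<ga = +-mono-<-≤ fa<ga (sumF-mono (f≤g ∘ F.suc))
sumF-mono-< {suc n} f≤g (F.suc a) fa<ga = +-mono-≤-< (f≤g F.zero) (sumF-mono-< (f≤g ∘ F.suc) a fa<ga)

sumF-split : ∀ m n (f : Fin (m + n) → ℕ) → sumF f ≡ sumF (f ∘ (_↑ˡ n)) + sumF (f ∘ (m ↑ʳ_))
sumF-split zero    n f = refl
sumF-split (suc m) n f = trans (cong (f F.zero +_) (sumF-split m n (f ∘ F.suc)))
                               (sym (+-assoc (f F.zero) (sumF (f ∘ F.suc ∘ (_↑ˡ n))) (sumF (f ∘ F.suc ∘ (m ↑ʳ_)))))

maxF-ub : ∀ {n} (f : Fin n → ℕ) x → f x ≤ maxF f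
maxF-ub f F.zero    = m≤m⊔n _ _
maxF-ub f (F.suc x) = ≤-trans (maxF-ub (f ∘ F.suc) x) (m≤n⊔m _ _)

maxF-lub : ∀ {n} {f : Fin n → ℕ} {M} → (∀ x → f x ≤ M) → maxF f ≤ M
maxF-lub {zero}  f≤M = z≤n
maxF-lub {suc n} f≤M = ⊔-lub (f≤M F.zero) (maxF-lub (f≤M ∘ F.suc))

maxF-split : ∀ m n (f : Fin (m + n) → ℕ) → maxF f ≡ maxF (f ∘ (_↑ˡ n)) ⊔ maxF (f ∘ (m ↑ʳ_))
maxF-split zero    n f = refl
maxF-split (suc m) n f = trans (cong (f F.zero ⊔_) (maxF-split m n (f ∘ F.suc)))
                               (sym (⊔-assoc (f F.zero) (maxF (f ∘ F.suc ∘ (_↑ˡ n))) (maxF (f ∘ F.suc ∘ (m ↑ʳ_)))))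

Δ-mono : ∀ {n} {r s : Fin n → Fin n → Bool} → r ⊆ᵇ₂ s → Δ (mkGraph n r) ≤ Δ (mkGraph n s)
Δ-mono r⊆s = maxF-lub λ i → ≤-trans (countB-mono (r⊆s i)) (maxF-ub _ i)

removedPair : (G : Graph) → (Fin (order G) → Fin (order G) → Bool) → Fin (order G) → Fin (order G) → Bool
removedPair G h i j = (toℕ i <ᵇ toℕ j) ∧ (adj G i j ∧ not (h i j))

removedAt : (G : Graph) → (Fin (order G) → Fin (order G) → Bool) → Fin (order G) → ℕ
removedAt G h i = countB (removedPair G h i)

removedPair-anti : ∀ G {h h′} → h ⊆ᵇ₂ h′ → ∀ i → removedPair G h′ i ⊆ᵇ removedPair G h i
removedPair-anti G {h} {h′} h⊆h′ i j with toℕ i <ᵇ toℕ j | adj G i j | h i j in hij | h′ i j in h′ij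
... | true  | true  | false | _    = λ _ → refl
... | true  | true  | true  | true  = λ ()
... | true  | true  | true  | false with () ← trans (sym (h⊆h′ i j hij)) h′ij
... | true  | false | _     | _    = λ ()
... | false | _     | _     | _    = λ ()

removed-< : ∀ G {h h′} → h ⊆ᵇ₂ h′ → ∀ {a b} → toℕ a < toℕ b → adj G a b ≡ true →
            h a b ≡ false → h′ a b ≡ true → removed G h′ < removed G h
removed-< G {h} {h′} h⊆h′ {a} {b} a<b ab hab h′ab =
  sumF-mono-< (λ i → countB-mono (removedPair-anti G h⊆h′ i)) a
    (countB-mono-< (removedPair-anti G h⊆h′ a) b (removedPair-ab h′ h′ab) (removedPair-ab h hab))
  where
    a<ᵇb : (toℕ a <ᵇ toℕ b) ≡ true
    a<ᵇb = Equivalence.to T-≡ (<⇒<ᵇ a<b)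
    removedPair-ab : ∀ k {c} → k a b ≡ c → removedPair G k a b ≡ not c
    removedPair-ab k kab = trans (cong₂ (λ l g → l ∧ (g ∧ not (k a b))) a<ᵇb ab) (cong not kab)

singleEdge : ∀ {n} → Fin n → Fin n → Fin n → Fin n → Bool
singleEdge a b x y = (does (a ≟ x) ∧ does (b ≟ y)) ∨ (does (b ≟ x) ∧ does (a ≟ y))

addEdge : ∀ {n} → (Fin n → Fin n → Bool) → Fin n → Fin n → Fin n → Fin n → Bool
addEdge h a b x y = h x y ∨ singleEdge a b x y

module _ {n} (a b : Fin n) where

  singleEdge-sym : ∀ x y → singleEdge a b x y ≡ singleEdge a b y x
  singleEdge-sym x y = trans (∨-comm (does (a ≟ x) ∧ does (b ≟ y)) _)
                         (cong₂ _∨_ (∧-comm (does (b ≟ x)) _) (∧-comm (does (a ≟ x)) _))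

  singleEdge-irrefl : a ≢ b → ∀ x → singleEdge a b x x ≡ false
  singleEdge-irrefl a≢b x with a ≟ x | b ≟ x
  ... | yes refl | yes refl = ⊥-elim (a≢b refl)
  ... | yes _    | no _     = refl
  ... | no _     | yes _    = refl
  ... | no _     | no _     = refl

  singleEdge⇒ : ∀ {x y} → singleEdge a b x y ≡ true → (a ≡ x × b ≡ y) ⊎ (b ≡ x × a ≡ y)
  singleEdge⇒ {x} {y} with a ≟ x | b ≟ y | b ≟ x | a ≟ y
  ... | yes a≡x | yes b≡y | _       | _       = λ _ → inj₁ (a≡x , b≡y)
  ... | _       | _       | yes b≡x | yes a≡y = λ _ → inj₂ (b≡x , a≡y)
  ... | yes _   | no _    | no _    | _       = λ ()
  ... | yes _   | no _    | yes _   | no _    = λ ()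
  ... | no _    | _       | no _    | _       = λ ()
  ... | no _    | _       | yes _   | no _    = λ ()

  countB-singleEdge : a ≢ b → ∀ x → countB (singleEdge a b x) ≤ 1
  countB-singleEdge a≢b x with a ≟ x | b ≟ x
  ... | yes refl | yes refl = ⊥-elim (a≢b refl)
  ... | yes refl | no _     = ≤-reflexive (trans (countB-cong λ y → ∨-identityʳ (does (b ≟ y))) (countB-≟ b))
  ... | no _     | yes refl = ≤-reflexive (countB-≟ a)
  ... | no _     | no _     = ≤-trans (≤-reflexive (countB-false {n})) z≤n

  module _ (h : Fin n → Fin n → Bool) where

    addEdge-⊇ : h ⊆ᵇ₂ addEdge h a b
    addEdge-⊇ x y hxy rewrite hxy = refl

    addEdge-new : addEdge h a b a b ≡ true
    addEdge-new with a ≟ a | b ≟ b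
    ... | yes _    | yes _    = ∨-zeroʳ (h a b)
    ... | no a≢a   | _        = ⊥-elim (a≢a refl)
    ... | _        | no b≢b   = ⊥-elim (b≢b refl)

    Δ-addEdge : a ≢ b → Δ (mkGraph n (addEdge h a b)) ≤ suc (Δ (mkGraph n h))
    Δ-addEdge a≢b = maxF-lub λ x → begin
      countB (addEdge h a b x)                  ≤⟨ countB-∨ (h x) (singleEdge a b x) ⟩
      countB (h x) + countB (singleEdge a b x)  ≤⟨ +-mono-≤ (maxF-ub (λ i → countB (h i)) x) (countB-singleEdge a≢b x) ⟩
      Δ (mkGraph n h) + 1                       ≡⟨ +-comm _ 1 ⟩
      suc (Δ (mkGraph n h))                     ∎
      where open ≤-Reasoning

module SpanningSubgraphs (G : Graph) (simple : IsSimple G) where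
  private
    n = order G
    G-sym = proj₁ simple
    G-irrefl = proj₂ simple

  adj⇒≢ : ∀ {a b} → adj G a b ≡ true → a ≢ b
  adj⇒≢ {a} ab refl with () ← trans (sym ab) (G-irrefl a)

  addEdge-spanSub : ∀ {h a b} → SpanSub G h → adj G a b ≡ true → SpanSub G (addEdge h a b)
  addEdge-spanSub {h} {a} {b} ((h-sym , h-irrefl) , h⊆G) ab =
    ( (λ x y → cong₂ _∨_ (h-sym x y) (singleEdge-sym a b x y))
    , (λ x → cong₂ _∨_ (h-irrefl x) (singleEdge-irrefl a b (adj⇒≢ ab) x)) )
    , addEdge⊆G
    where
      edge⊆G : ∀ {x y} → (a ≡ x × b ≡ y) ⊎ (b ≡ x × a ≡ y) → adj G x y ≡ true
      edge⊆G (inj₁ (refl , refl)) = ab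
      edge⊆G (inj₂ (refl , refl)) = trans (G-sym b a) ab
      addEdge⊆G : addEdge h a b ⊆ᵇ₂ adj G
      addEdge⊆G x y with h x y in hxy
      ... | true  = λ _ → h⊆G x y hxy
      ... | false = edge⊆G ∘ singleEdge⇒ a b

  MissingEdge : (Fin n → Fin n → Bool) → Fin n → Fin n → Set
  MissingEdge h a b = toℕ a < toℕ b × adj G a b ≡ true × h a b ≡ false

  missingEdge? : ∀ h → (∀ x y → h x y ≡ h y x) → adj G ⊆ᵇ₂ h ⊎ ∃[ a ] ∃[ b ] MissingEdge h a b
  missingEdge? h h-sym
    with any? (λ a → any? (λ b → (toℕ a <? toℕ b) ×-dec (adj G a b Bool.≟ true) ×-dec (h a b Bool.≟ false)))
  ... | yes (a , b , missing) = inj₂ (a , b , missing)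
  ... | no none = inj₁ covered
    where
      covered : adj G ⊆ᵇ₂ h
      covered a b ab with <-cmp (toℕ a) (toℕ b)
      ... | tri< a<b _ _ = ¬-not λ hab → none (a , b , a<b , ab , hab)
      ... | tri≈ _ a≡b _ = ⊥-elim (adj⇒≢ ab (toℕ-injective a≡b))
      ... | tri> _ _ b<a = trans (h-sym a b) (¬-not λ hba → none (b , a , b<a , trans (G-sym b a) ab , hba))

  Saturation : ℕ → (Fin n → Fin n → Bool) → Set
  Saturation D h = ∃[ h′ ] SpanSub G h′ × Δ (mkGraph n h′) ≡ D × removed G h′ ≤ removed G h

  saturate : ∀ {D} → D ≤ Δ G → ∀ h → SpanSub G h → Δ (mkGraph n h) ≤ D → Saturation D h
  saturate {D} D≤ΔG h = saturate-acc h (<-wellFounded (removed G h))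
    where
      saturate-acc : ∀ h → Acc _<_ (removed G h) → SpanSub G h → Δ (mkGraph n h) ≤ D → Saturation D h
      saturate-acc h (acc smaller) h⊆G Δh≤D with m≤n⇒m<n∨m≡n Δh≤D | missingEdge? h (proj₁ (proj₁ h⊆G))
      ... | inj₂ Δh≡D | _        = h , h⊆G , Δh≡D , ≤-refl
      ... | inj₁ Δh<D | inj₁ G⊆h = ⊥-elim (<-irrefl refl (<-≤-trans Δh<D (≤-trans D≤ΔG (Δ-mono G⊆h))))
      ... | inj₁ Δh<D | inj₂ (a , b , a<b , ab , hab) =
        let h′ , h′⊆G , Δh′≡D , fewer = saturate-acc (addEdge h a b) (smaller shrinks) (addEdge-spanSub h⊆G ab)
                                                     (≤-trans (Δ-addEdge a b h (adj⇒≢ ab)) Δh<D)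
        in h′ , h′⊆G , Δh′≡D , ≤-trans fewer (<⇒≤ shrinks)
        where
          shrinks : removed G (addEdge h a b) < removed G h
          shrinks = removed-< G (addEdge-⊇ a b h) a<b ab hab (addEdge-new a b h)

RemovalLowerBound : Graph → ℕ → ℕ → Set
RemovalLowerBound G D k = ∀ h → SpanSub G h → Δ (mkGraph (order G) h) ≤ D → k ≤ removed G h

esΔ⇒removalLowerBound : ∀ {G k} → IsSimple G → IsEsΔ G k → RemovalLowerBound G (Δ G ∸ 1) k
esΔ⇒removalLowerBound {G} simple (_ , minimal) h h⊆G Δh≤D =
  let h′ , h′⊆G , Δh′≡D , fewer = saturate (m∸n≤m (Δ G) 1) h h⊆G Δh≤D
  in ≤-trans (minimal h′ h′⊆G Δh′≡D) fewer
  where open SpanningSubgraphs G simple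

module Restriction {G G′ : Graph} (e : Fin (order G) → Fin (order G′))
  (adj-e : ∀ i j → adj G′ (e i) (e j) ≡ adj G i j)
  (<ᵇ-e : ∀ i j → (toℕ (e i) <ᵇ toℕ (e j)) ≡ (toℕ i <ᵇ toℕ j))
  (countB-e : ∀ f → countB (f ∘ e) ≤ countB f)
  where

  restrict : (Fin (order G′) → Fin (order G′) → Bool) → Fin (order G) → Fin (order G) → Bool
  restrict h i j = h (e i) (e j)

  restrict-spanSub : ∀ {h} → SpanSub G′ h → SpanSub G (restrict h)
  restrict-spanSub ((h-sym , h-irrefl) , h⊆G′) =
    ((λ i j → h-sym (e i) (e j)) , h-irrefl ∘ e) , λ i j hij → trans (sym (adj-e i j)) (h⊆G′ (e i) (e j) hij)

  Δ-restrict : ∀ h → Δ (mkGraph (order G) (restrict h)) ≤ Δ (mkGraph (order G′) h)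
  Δ-restrict h = maxF-lub λ i → ≤-trans (countB-e (h (e i))) (maxF-ub (λ u → countB (h u)) (e i))

  removedAt-restrict : ∀ h i → removedAt G (restrict h) i ≤ removedAt G′ h (e i)
  removedAt-restrict h i = ≤-trans (≤-reflexive (countB-cong λ j →
      cong₂ (λ l g → l ∧ (g ∧ not (h (e i) (e j)))) (sym (<ᵇ-e i j)) (sym (adj-e i j))))
    (countB-e _)

toℕ-≡ᵇ : ∀ {n} (i j : Fin n) → (toℕ i ≡ᵇ toℕ j) ≡ does (i ≟ j)
toℕ-≡ᵇ F.zero    F.zero    = refl
toℕ-≡ᵇ F.zero    (F.suc j) = refl
toℕ-≡ᵇ (F.suc i) F.zero    = refl
toℕ-≡ᵇ (F.suc i) (F.suc j) = toℕ-≡ᵇ i j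

+-cancelˡ-<ᵇ : ∀ n a b → ((n + a) <ᵇ (n + b)) ≡ (a <ᵇ b)
+-cancelˡ-<ᵇ zero    a b = refl
+-cancelˡ-<ᵇ (suc n) a b = +-cancelˡ-<ᵇ n a b

module _ (G : Graph) where
  private
    n = order G

  adj-double-ˡˡ : ∀ i j → adj (double G) (i ↑ˡ n) (j ↑ˡ n) ≡ adj G i j
  adj-double-ˡˡ i j rewrite splitAt-↑ˡ n i n | splitAt-↑ˡ n j n = refl

  adj-double-ʳʳ : ∀ i j → adj (double G) (n ↑ʳ i) (n ↑ʳ j) ≡ adj G i j
  adj-double-ʳʳ i j rewrite splitAt-↑ʳ n n i | splitAt-↑ʳ n n j = refl

  twin : Fin n → Fin n → Bool
  twin i j = (toℕ i ≡ᵇ toℕ j) ∧ not (deg G i ≡ᵇ Δ G)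

  adj-double-ˡʳ : ∀ i j → adj (double G) (i ↑ˡ n) (n ↑ʳ j) ≡ twin i j
  adj-double-ˡʳ i j rewrite splitAt-↑ˡ n i n | splitAt-↑ʳ n n j = refl

  adj-double-ʳˡ : ∀ i j → adj (double G) (n ↑ʳ i) (j ↑ˡ n) ≡ twin i j
  adj-double-ʳˡ i j rewrite splitAt-↑ʳ n n i | splitAt-↑ˡ n j n = refl

  deg+twins≤Δ : ∀ i → deg G i + countB (twin i) ≤ Δ G
  deg+twins≤Δ i with deg G i ≡ᵇ Δ G in core
  ... | true  = begin
    deg G i + countB {n} (λ j → (toℕ i ≡ᵇ toℕ j) ∧ false)
      ≡⟨ cong (deg G i +_) (trans (countB-cong {n} λ j → ∧-zeroʳ (toℕ i ≡ᵇ toℕ j)) (countB-false {n})) ⟩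
    deg G i + 0
      ≡⟨ +-identityʳ _ ⟩
    deg G i
      ≤⟨ maxF-ub (deg G) i ⟩
    Δ G ∎
    where open ≤-Reasoning
  ... | false = begin
    deg G i + countB {n} (λ j → (toℕ i ≡ᵇ toℕ j) ∧ true)
      ≡⟨ cong (deg G i +_) (trans (countB-cong λ j → trans (∧-identityʳ _) (toℕ-≡ᵇ i j)) (countB-≟ i)) ⟩
    deg G i + 1
      ≡⟨ +-comm _ 1 ⟩
    suc (deg G i)
      ≤⟨ ≤∧≢⇒< (maxF-ub (deg G) i) (λ deg≡Δ → subst T core (≡⇒≡ᵇ _ _ deg≡Δ)) ⟩
    Δ G ∎
    where open ≤-Reasoning

  Δ-double : Δ (double G) ≤ Δ G
  Δ-double = begin
    Δ (double G)                                                        ≡⟨ maxF-split n n (deg (double G)) ⟩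
    maxF (deg (double G) ∘ (_↑ˡ n)) ⊔ maxF (deg (double G) ∘ (n ↑ʳ_))  ≤⟨ ⊔-lub (maxF-lub left) (maxF-lub right) ⟩
    Δ G                                                                 ∎
    where
      open ≤-Reasoning
      left : ∀ i → deg (double G) (i ↑ˡ n) ≤ Δ G
      left i = begin
        deg (double G) (i ↑ˡ n)      ≡⟨ countB-split n n _ ⟩
        _                            ≡⟨ cong₂ _+_ (countB-cong (adj-double-ˡˡ i)) (countB-cong (adj-double-ˡʳ i)) ⟩
        deg G i + countB (twin i)    ≤⟨ deg+twins≤Δ i ⟩
        Δ G                          ∎
      right : ∀ i → deg (double G) (n ↑ʳ i) ≤ Δ G
      right i = begin
        deg (double G) (n ↑ʳ i)      ≡⟨ countB-split n n _ ⟩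
        _                            ≡⟨ cong₂ _+_ (countB-cong (adj-double-ʳˡ i)) (countB-cong (adj-double-ʳʳ i)) ⟩
        countB (twin i) + deg G i    ≡⟨ +-comm (countB (twin i)) _ ⟩
        deg G i + countB (twin i)    ≤⟨ deg+twins≤Δ i ⟩
        Δ G                          ∎

  private
    module Left = Restriction {G} {double G} (_↑ˡ n) adj-double-ˡˡ
      (λ i j → cong₂ _<ᵇ_ (toℕ-↑ˡ i n) (toℕ-↑ˡ j n))
      (λ f → ≤-trans (m≤m+n _ _) (≤-reflexive (sym (countB-split n n f))))
    module Right = Restriction {G} {double G} (n ↑ʳ_) adj-double-ʳʳ
      (λ i j → trans (cong₂ _<ᵇ_ (toℕ-↑ʳ n i) (toℕ-↑ʳ n j)) (+-cancelˡ-<ᵇ n (toℕ i) (toℕ j)))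
      (λ f → ≤-trans (m≤n+m _ _) (≤-reflexive (sym (countB-split n n f))))

  removalLowerBound-double : ∀ {D k} → RemovalLowerBound G D k → RemovalLowerBound (double G) D (k + k)
  removalLowerBound-double {D} {k} bound h h⊆G² Δh≤D = begin
    k + k
      ≤⟨ +-mono-≤ (bound _ (Left.restrict-spanSub h⊆G²) (≤-trans (Left.Δ-restrict h) Δh≤D))
                  (bound _ (Right.restrict-spanSub h⊆G²) (≤-trans (Right.Δ-restrict h) Δh≤D)) ⟩
    removed G (Left.restrict h) + removed G (Right.restrict h)
      ≤⟨ +-mono-≤ (sumF-mono (Left.removedAt-restrict h)) (sumF-mono (Right.removedAt-restrict h)) ⟩
    sumF (removedAt (double G) h ∘ (_↑ˡ n)) + sumF (removedAt (double G) h ∘ (n ↑ʳ_))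
      ≡⟨ sym (sumF-split n n (removedAt (double G) h)) ⟩
    removed (double G) h ∎
    where open ≤-Reasoning

m*[n+n]≡2*m*n : ∀ m n → m * (n + n) ≡ 2 * m * n
m*[n+n]≡2*m*n = solve-∀

Δ-iter : ∀ m G → Δ (iter m G) ≤ Δ G
Δ-iter zero    G = ≤-refl
Δ-iter (suc m) G = ≤-trans (Δ-iter m (double G)) (Δ-double G)

order-iter : ∀ m G → order (iter m G) ≡ 2 ^ m * order G
order-iter zero    G = sym (+-identityʳ (order G))
order-iter (suc m) G = trans (order-iter m (double G)) (m*[n+n]≡2*m*n (2 ^ m) (order G))

removalLowerBound-iter : ∀ m {G D k} → RemovalLowerBound G D k → RemovalLowerBound (iter m G) D (2 ^ m * k)
removalLowerBound-iter zero    {k = k} bound = subst (RemovalLowerBound _ _) (sym (+-identityʳ k)) bound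
removalLowerBound-iter (suc m) {G} {D} {k} bound =
  subst (RemovalLowerBound (iter m (double G)) D) (m*[n+n]≡2*m*n (2 ^ m) k)
        (removalLowerBound-iter m (removalLowerBound-double G bound))

lemma3p1 : (G : Graph) → IsSimple G → HasEdge G →
    (k k′ : ℕ) → IsEsΔ G k → IsEsΔ (R G) k′ →
    order (R G) * k ≤ order G * k′
lemma3p1 G simple _ k k′ esΔG esΔRG = begin
    order (R G) * k          ≡⟨ cong (_* k) (order-iter m G) ⟩
    2 ^ m * order G * k      ≡⟨ cong (_* k) (*-comm (2 ^ m) (order G)) ⟩
    order G * 2 ^ m * k      ≡⟨ *-assoc (order G) (2 ^ m) k ⟩
    order G * (2 ^ m * k)    ≤⟨ *-monoʳ-≤ (order G) 2ᵐk≤k′ ⟩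
    order G * k′             ∎
  where
    open ≤-Reasoning
    m = Δ G ∸ δ G
    2ᵐk≤k′ : 2 ^ m * k ≤ k′
    2ᵐk≤k′ =
      let h , h⊆RG , Δh≡Δ∸1 , removed≡k′ = proj₁ esΔRG
      in subst (2 ^ m * k ≤_) removed≡k′
           (removalLowerBound-iter m (esΔ⇒removalLowerBound simple esΔG) h h⊆RG
             (≤-trans (≤-reflexive Δh≡Δ∸1) (∸-monoˡ-≤ 1 (Δ-iter m G))))
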